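{- Let $w\in S_n$, let $(a,b)$ be a lower outside corner of $D(w)$, and let $v=wt_{a,w^{ -1}(b)}$. If $U\subseteq\phi(w,z_{a,b})$ and $U\ne\emptyset$, then $w_U=\vee\{vt_{i,a}: i\in U\}$.
   Context: For $w\in S_n$: $\ell(w)$ Coxeter length; $wt_{i,j}$ is $w$ with entries in positions $i,j$ swapped; ${\tt rk}_w(a,b)=\#\{i\le a:w(i)\le b\}$; $D(w)=\{(i,j):w(i)>j,\ w^{ -1}(j)>i\}$; a lower outside corner of $D(w)$ is $(a,b)\in D(w)$ with no other $(c,d)\in D(w)$ having $c\ge a,d\ge b$; Bruhat order $u\le u'$ iff ${\tt rk}_u\ge{\tt rk}_{u'}$ entrywise. $\phi(w,z_{a,b})=\{i\in[a-1]: vt_{i,a}>v,\ \ell(vt_{i,a})=\ell(v)+1\}$. For $U=\{i_1<\cdots<i_k\}\subseteq\phi(w,z_{a,b})$, $w_U=v\circ(a\ i_k\ i_{k-1}\ \cdots\ i_1)$, where the cycle sends $a\mapsto i_k\mapsto i_{k-1}\mapsto\cdots\mapsto i_1\mapsto a$ and is applied first. The join $\vee$ is taken in the lattice of $n\times n$ alternating sign matrices ($\{ -1,0,1\}$-matrices with row and column sums 1 and alternating nonzero entries), ordered by $A\ge B$ iff ${\tt rk}_A\le{\tt rk}_B$ entrywise with ${\tt rk}_A(a,b)=\sum_{i\le a,j\le b}A_{i,j}$; the join's corner sum function is the entrywise minimum, and permutations are identified with permutation matrices (1's at $(i,w(i))$). -}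

module Defs where

open import Data.Nat using (ℕ; zero; suc)
open import Data.Integer using (ℤ; 0ℤ; 1ℤ; -1ℤ; _+_; _≤_)
open import Data.Fin using (Fin; zero; suc; _≟_; _<?_; _≤?_) renaming (_<_ to _<ᶠ_; _≤_ to _≤ᶠ_)
open import Data.Fin.Permutation using (Permutation′; _⟨$⟩ʳ_; _⟨$⟩ˡ_)
open import Data.List using (List; []; _∷_; length; filter; cartesianProduct; allFin; reverse)
open import Data.List.Relation.Unary.All using (All)
open import Data.List.Relation.Unary.AllPairs using (AllPairs)
open import Data.List.Membership.Propositional using (_∈_)
open import Data.Product using (_×_; _,_; ∃-syntax; Σ-syntax)
open import Data.Product.Relation.Binary.Pointwise.NonDependent using ()
open import Data.Sum using (_⊎_)
open import Relation.Nullary using (¬_; yes; no)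
open import Relation.Nullary.Decidable using (_×-dec_)
open import Relation.Binary.PropositionalEquality using (_≡_; _≢_)

-- Conventions: positions and values are 0-indexed elements of Fin n
-- (paper's index k corresponds to Fin element k-1).

Fun : ℕ → Set
Fun n = Fin n → Fin n

⟦_⟧ : ∀ {n} → Permutation′ n → Fun n
⟦ w ⟧ = w ⟨$⟩ʳ_

tr : ∀ {n} → Fin n → Fin n → Fun n
tr i j k with k ≟ i
... | yes _ = j
... | no _ with k ≟ j
...   | yes _ = i
...   | no _ = k

_t[_,_] : ∀ {n} → Fun n → Fin n → Fin n → Fun n
(w t[ i , j ]) k = w (tr i j k)

ℓ : ∀ {n} → Fun n → ℕ
ℓ {n} w = length (filter (λ p → (Data.Product.proj₁ p <? Data.Product.proj₂ p)
                                 ×-dec (w (Data.Product.proj₂ p) <? w (Data.Product.proj₁ p)))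
                         (cartesianProduct (allFin n) (allFin n)))

rk : ∀ {n} → Fun n → Fin n → Fin n → ℕ
rk {n} w a b = length (filter (λ i → (i ≤? a) ×-dec (w i ≤? b)) (allFin n))

_≤B_ : ∀ {n} → Fun n → Fun n → Set
u ≤B u' = ∀ a b → rk u' a b Data.Nat.≤ rk u a b

_<B_ : ∀ {n} → Fun n → Fun n → Set
u <B u' = u ≤B u' × ¬ (∀ k → u k ≡ u' k)

InD : ∀ {n} → Permutation′ n → Fin n → Fin n → Set
InD w i j = (j <ᶠ (w ⟨$⟩ʳ i)) × (i <ᶠ (w ⟨$⟩ˡ j))

LowerOutsideCorner : ∀ {n} → Permutation′ n → Fin n → Fin n → Set
LowerOutsideCorner w a b =
  InD w a b × (∀ c d → InD w c d → a ≤ᶠ c → b ≤ᶠ d → (c ≡ a × d ≡ b))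

vOf : ∀ {n} → Permutation′ n → Fin n → Fin n → Fun n
vOf w a b = ⟦ w ⟧ t[ a , w ⟨$⟩ˡ b ]

Inφ : ∀ {n} → Permutation′ n → Fin n → Fin n → Fin n → Set
Inφ w a b i = let v = vOf w a b in
  (i <ᶠ a) × (v <B (v t[ i , a ])) × (ℓ (v t[ i , a ]) ≡ suc (ℓ v))

-- cycle (c₀ c₁ … c_m): c₀ ↦ c₁ ↦ … ↦ c_m ↦ c₀, other points fixed
-- cycleGo c₀ y rest x : x's image, where y ∷ rest is the remaining tail of the cycle
cycleGo : ∀ {n} → Fin n → Fin n → List (Fin n) → Fun n
cycleGo c y [] x with x ≟ y
... | yes _ = c
... | no _ = x
cycleGo c y (z ∷ rest) x with x ≟ y
... | yes _ = z
... | no _ = cycleGo c z rest x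

cycleFn : ∀ {n} → List (Fin n) → Fun n
cycleFn [] x = x
cycleFn (c ∷ cs) x = cycleGo c c cs x

-- w_U = v ∘ (a i_k i_{k-1} ⋯ i_1), where U = {i_1 < ⋯ < i_k} is given as
-- the increasing list [i_1, …, i_k]; the cycle is applied first.
wU : ∀ {n} → Permutation′ n → Fin n → Fin n → List (Fin n) → Fun n
wU w a b U x = vOf w a b (cycleFn (a ∷ reverse U) x)

Matrix : ℕ → Set
Matrix n = Fin n → Fin n → ℤ

ΣFin : ∀ {n} → (Fin n → ℤ) → ℤ
ΣFin {zero} f = 0ℤ
ΣFin {suc n} f = f zero + ΣFin (λ i → f (suc i))

ΣUpTo : ∀ {n} → Fin n → (Fin n → ℤ) → ℤ
ΣUpTo a f = ΣFin (λ i → restrict i)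
  where
  restrict : Fin _ → ℤ
  restrict i with i ≤? a
  ... | yes _ = f i
  ... | no _ = 0ℤ

record IsASM {n} (A : Matrix n) : Set where
  field
    entries   : ∀ i j → (A i j ≡ -1ℤ) ⊎ (A i j ≡ 0ℤ) ⊎ (A i j ≡ 1ℤ)
    rowSum    : ∀ i → ΣFin (λ j → A i j) ≡ 1ℤ
    colSum    : ∀ j → ΣFin (λ i → A i j) ≡ 1ℤ
    -- consecutive nonzero entries in a row / column have opposite signs
    rowAlt    : ∀ i j j' → j <ᶠ j' → A i j ≢ 0ℤ → A i j ≡ A i j' →
                ∃[ k ] (j <ᶠ k × k <ᶠ j' × A i k ≢ 0ℤ)
    colAlt    : ∀ j i i' → i <ᶠ i' → A i j ≢ 0ℤ → A i j ≡ A i' j →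
                ∃[ k ] (i <ᶠ k × k <ᶠ i' × A k j ≢ 0ℤ)

rkA : ∀ {n} → Matrix n → Fin n → Fin n → ℤ
rkA A a b = ΣUpTo a (λ i → ΣUpTo b (λ j → A i j))

-- A ≥ B iff rk_A ≤ rk_B entrywise; we write B ⊑ A
_⊑_ : ∀ {n} → Matrix n → Matrix n → Set
B ⊑ A = ∀ a b → rkA A a b ≤ rkA B a b

permMat : ∀ {n} → Fun n → Matrix n
permMat w i j with w i ≟ j
... | yes _ = 1ℤ
... | no _ = 0ℤ

IsJoin : ∀ {n} {X : Set} → (X → Set) → (X → Matrix n) → Matrix n → Set
IsJoin {n} S M J =
  IsASM J
  × (∀ x → S x → M x ⊑ J)
  × (∀ (A : Matrix n) → IsASM A → (∀ x → S x → M x ⊑ A) → J ⊑ A)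

{-# OPTIONS --safe #-}
-- Write vᵢ = v tᵢ,ₐ. As v < vᵢ is a Bruhat cover, v(i) < v(a), and no j strictly between i and a
-- has v(i) < v(j) < v(a), for that would give ℓ(vᵢ) ≥ ℓ(v) + 2; hence v decreases along
-- U = {i₁ < ⋯ < iₖ}. The cycle factors as w_U = v tᵢ₁,ₐ ⋯ tᵢₖ,ₐ. Fix a corner (x, y). If x ≥ a,
-- or every iⱼ exceeds x, none of these swaps changes the rank at (x, y). Otherwise the swaps with
-- iⱼ ≤ x bring v(a) into the rows ≤ x and, in the end, take out only v(iᵣ) for the last such iᵣ;
-- so rk_{w_U}(x, y) = rk_{vᵢᵣ}(x, y), and since v(iᵣ) is the least of those values and lies below
-- v(a), this is the minimum of the rk_{vᵢ}(x, y). A permutation matrix whose corner sums are the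
-- pointwise minimum over a family is the join of that family among alternating sign matrices.
module Submission where

open import Defs
open import Data.Nat.Properties hiding (_≟_; _<?_; _≤?_)
open import Algebra.Properties.CommutativeMonoid.Sum +-0-commutativeMonoid
  using (sum; sum-cong-≗; sum-remove; sum-replicate-zero; ∑-distrib-+)
open import Algebra.Properties.CommutativeSemigroup +-commutativeSemigroup using (xy∙z≈y∙xz; x∙yz≈y∙xz)
open import Data.Empty using (⊥-elim)
open import Data.Fin using (Fin; zero; suc; _≟_; _<?_; _≤?_; punchIn) renaming (_<_ to _<ᶠ_; _≤_ to _≤ᶠ_)
open import Data.Fin.Permutation using (Permutation′; _⟨$⟩ˡ_; inverseˡ; inverseʳ)
open import Data.Fin.Properties using (punchInᵢ≢i) renaming (<⇒≢ to <⇒≢ᶠ; ≤∧≢⇒< to ≤∧≢⇒<ᶠ)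
open import Data.Integer as ℤ using (ℤ; 0ℤ; 1ℤ; -1ℤ) renaming (+_ to ℤ+_)
import Data.Integer.Properties as ℤₚ
open import Data.List using (List; []; _∷_; _++_; foldl; foldr; reverse; length; filter; tabulate; map; allFin; cartesianProduct)
open import Data.List.Membership.Propositional using (_∈_)
open import Data.List.Properties using (filter-++; length-++; map-tabulate; reverse-foldl)
import Data.List.Relation.Binary.Permutation.Setoid as Perm
import Data.List.Relation.Binary.Permutation.Setoid.Properties as PermProps
open import Data.List.Relation.Unary.All as All using (All; []; _∷_)
open import Data.List.Relation.Unary.AllPairs as AllPairs using (AllPairs; []; _∷_)
open import Data.List.Relation.Unary.Any using (here; there)
open import Data.Nat using (ℕ; zero; suc; _+_; _*_; _≤_; z≤n)
open import Data.Nat.Tactic.RingSolver using (solve-∀)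
open import Data.Product using (Σ; ∃-syntax; _×_; _,_; proj₁; proj₂)
open import Data.Sum using (_⊎_; inj₁; inj₂)
open import Data.Vec.Functional using (updateAt)
open import Data.Vec.Functional.Properties using (updateAt-updates; updateAt-minimal)
open import Function using (_∘_; id; const)
open import Relation.Binary.PropositionalEquality
open import Relation.Nullary using (¬_; Dec; yes; no)
open import Relation.Nullary.Decidable using (_×-dec_)
open import Relation.Unary using (Pred; Decidable)

χ : ∀ {p} {P : Set p} → Dec P → ℕ
χ (yes _) = 1
χ (no _) = 0

χ-yes : ∀ {p} {P : Set p} {d : Dec P} → P → χ d ≡ 1
χ-yes {d = yes _} _ = refl
χ-yes {d = no ¬p} p = ⊥-elim (¬p p)

χ-no : ∀ {p} {P : Set p} {d : Dec P} → ¬ P → χ d ≡ 0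
χ-no {d = yes p} ¬p = ⊥-elim (¬p p)
χ-no {d = no _} _ = refl

χ-mono : ∀ {p q} {P : Set p} {Q : Set q} (d : Dec P) (e : Dec Q) → (P → Q) → χ d ≤ χ e
χ-mono (yes p) (yes q) _ = ≤-refl
χ-mono (yes p) (no ¬q) P⇒Q = ⊥-elim (¬q (P⇒Q p))
χ-mono (no _) _ _ = z≤n

χ-×-dec : ∀ {p q} {P : Set p} {Q : Set q} (d : Dec P) (e : Dec Q) → χ (d ×-dec e) ≡ χ d * χ e
χ-×-dec (yes _) (yes _) = refl
χ-×-dec (yes _) (no _) = refl
χ-×-dec (no _) (yes _) = refl
χ-×-dec (no _) (no _) = refl

length-filter-tabulate : ∀ {a} {A : Set a} {m} {P : Pred A a} (P? : Decidable P) (h : Fin m → A) →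
                         length (filter P? (tabulate h)) ≡ sum (λ q → χ (P? (h q)))
length-filter-tabulate {m = zero} P? h = refl
length-filter-tabulate {m = suc m} P? h with P? (h zero)
... | yes _ = cong suc (length-filter-tabulate P? (h ∘ suc))
... | no _ = length-filter-tabulate P? (h ∘ suc)

sum-mono : ∀ {n} {f g : Fin n → ℕ} → (∀ p → f p ≤ g p) → sum f ≤ sum g
sum-mono {zero} f≤g = z≤n
sum-mono {suc n} f≤g = +-mono-≤ (f≤g zero) (sum-mono (f≤g ∘ suc))

sum-point : ∀ {n} {f : Fin n → ℕ} (k : Fin n) → (∀ p → p ≢ k → f p ≡ 0) → sum f ≡ f k
sum-point {suc n} {f} k vanish = begin
  sum f                          ≡⟨ sum-remove {i = k} f ⟩
  f k + sum (f ∘ punchIn k)      ≡⟨ cong (f k +_) (sum-cong-≗ (λ p → vanish _ (punchInᵢ≢i k p))) ⟩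
  f k + sum {n} (λ _ → 0)        ≡⟨ cong (f k +_) (sum-replicate-zero n) ⟩
  f k + 0                        ≡⟨ +-identityʳ (f k) ⟩
  f k                            ∎
  where open ≡-Reasoning

sum-≤-except : ∀ {n} {f g : Fin n → ℕ} (k : Fin n) {c d : ℕ} → (∀ p → p ≢ k → f p ≤ g p) →
               f k + c ≤ g k + d → sum f + c ≤ sum g + d
sum-≤-except {suc n} {f} {g} k {c} {d} f≤g at-k = begin
  sum f + c                          ≡⟨ cong (_+ c) (sum-remove {i = k} f) ⟩
  f k + sum (f ∘ punchIn k) + c      ≡⟨ xy∙z≈y∙xz (f k) _ c ⟩
  sum (f ∘ punchIn k) + (f k + c)    ≤⟨ +-mono-≤ (sum-mono (λ p → f≤g _ (punchInᵢ≢i k p))) at-k ⟩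
  sum (g ∘ punchIn k) + (g k + d)    ≡⟨ sym (xy∙z≈y∙xz (g k) _ d) ⟩
  g k + sum (g ∘ punchIn k) + d      ≡⟨ cong (_+ d) (sym (sum-remove {i = k} g)) ⟩
  sum g + d                          ∎
  where open ≤-Reasoning

sum-≤-except₂ : ∀ {n} {f g : Fin n → ℕ} {i k : Fin n} {c d : ℕ} → i ≢ k → (∀ p → p ≢ i → p ≢ k → f p ≤ g p) →
                f i + f k + c ≤ g i + g k + d → sum f + c ≤ sum g + d
sum-≤-except₂ {f = f} {g} {i} {k} {c} {d} i≢k f≤g at-i,k =
  +-cancelˡ-≤ (g k) _ _ (begin
    g k + (sum f + c)      ≡⟨ x∙yz≈y∙xz (g k) (sum f) c ⟩
    sum f + (g k + c)      ≤⟨ sum-≤-except k f≤h at-k ⟩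
    sum h + (f k + c)      ≤⟨ sum-≤-except i h≤g at-i ⟩
    sum g + (g k + d)      ≡⟨ x∙yz≈y∙xz (sum g) (g k) d ⟩
    g k + (sum g + d)      ∎)
  where
  open ≤-Reasoning
  h : Fin _ → ℕ
  h = updateAt f k (const (g k))
  h-off : ∀ p → p ≢ k → h p ≡ f p
  h-off p p≢k = updateAt-minimal p k f p≢k
  f≤h : ∀ p → p ≢ k → f p ≤ h p
  f≤h p p≢k = ≤-reflexive (sym (h-off p p≢k))
  at-k : f k + (g k + c) ≤ h k + (f k + c)
  at-k = ≤-reflexive (trans (x∙yz≈y∙xz (f k) (g k) c) (cong (_+ (f k + c)) (sym (updateAt-updates k f))))
  h≤g : ∀ p → p ≢ i → h p ≤ g p
  h≤g p p≢i with p ≟ k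
  ... | yes refl = ≤-reflexive (updateAt-updates p f)
  ... | no p≢k = ≤-trans (≤-reflexive (h-off p p≢k)) (f≤g p p≢i p≢k)
  at-i : h i + (f k + c) ≤ g i + (g k + d)
  at-i = begin
    h i + (f k + c)      ≡⟨ cong (_+ (f k + c)) (h-off i i≢k) ⟩
    f i + (f k + c)      ≡⟨ sym (+-assoc (f i) (f k) c) ⟩
    f i + f k + c        ≤⟨ at-i,k ⟩
    g i + g k + d        ≡⟨ +-assoc (g i) (g k) d ⟩
    g i + (g k + d)      ∎

sum-≡-except₂ : ∀ {n} {f g : Fin n → ℕ} {i k : Fin n} {c d : ℕ} → i ≢ k → (∀ p → p ≢ i → p ≢ k → f p ≡ g p) →
                f i + f k + c ≡ g i + g k + d → sum f + c ≡ sum g + d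
sum-≡-except₂ i≢k f≡g at-i,k =
  ≤-antisym (sum-≤-except₂ i≢k (λ p p≢i p≢k → ≤-reflexive (f≡g p p≢i p≢k)) (≤-reflexive at-i,k))
            (sum-≤-except₂ i≢k (λ p p≢i p≢k → ≤-reflexive (sym (f≡g p p≢i p≢k))) (≤-reflexive (sym at-i,k)))

tr-left : ∀ {n} (i j : Fin n) → tr i j i ≡ j
tr-left i j with i ≟ i
... | yes _ = refl
... | no i≢i = ⊥-elim (i≢i refl)

tr-right : ∀ {n} (i j : Fin n) → tr i j j ≡ i
tr-right i j with j ≟ i
... | yes refl = refl
... | no _ with j ≟ j
...   | yes _ = refl
...   | no j≢j = ⊥-elim (j≢j refl)

tr-other : ∀ {n} {i j k : Fin n} → k ≢ i → k ≢ j → tr i j k ≡ k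
tr-other {i = i} {j} {k} k≢i k≢j with k ≟ i
... | yes k≡i = ⊥-elim (k≢i k≡i)
... | no _ with k ≟ j
...   | yes k≡j = ⊥-elim (k≢j k≡j)
...   | no _ = refl

tr-involutive : ∀ {n} (i j k : Fin n) → tr i j (tr i j k) ≡ k
tr-involutive i j k with k ≟ i
... | yes refl = tr-right k j
... | no k≢i with k ≟ j
...   | yes refl = tr-left i k
...   | no k≢j = tr-other k≢i k≢j

module _ {n : ℕ} (x y : Fin n) where

  cell : Fin n → Fin n → ℕ
  cell p z = χ (p ≤? x) * χ (z ≤? y)

  cell-in : ∀ {p} z → p ≤ᶠ x → cell p z ≡ χ (z ≤? y)
  cell-in {p} z p≤x = trans (cong (_* χ (z ≤? y)) (χ-yes {d = p ≤? x} p≤x)) (*-identityˡ _)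

  cell-out : ∀ {p} z → ¬ p ≤ᶠ x → cell p z ≡ 0
  cell-out {p} z p≰x = cong (_* χ (z ≤? y)) (χ-no {d = p ≤? x} p≰x)

  rk-as-sum : (u : Fun n) → rk u x y ≡ sum (λ p → cell p (u p))
  rk-as-sum u = trans (length-filter-tabulate (λ p → (p ≤? x) ×-dec (u p ≤? y)) id)
                      (sum-cong-≗ (λ p → χ-×-dec (p ≤? x) (u p ≤? y)))

  rk-cong : {u u′ : Fun n} → (∀ p → u p ≡ u′ p) → rk u x y ≡ rk u′ x y
  rk-cong {u} {u′} u≗u′ = trans (rk-as-sum u) (trans (sum-cong-≗ (λ p → cong (cell p) (u≗u′ p))) (sym (rk-as-sum u′)))

  rk-swap : (u : Fun n) {i a : Fin n} → i ≢ a →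
            rk (u t[ i , a ]) x y + (cell i (u i) + cell a (u a)) ≡ rk u x y + (cell i (u a) + cell a (u i))
  rk-swap u {i} {a} i≢a = begin
    rk (u t[ i , a ]) x y + (cell i (u i) + cell a (u a))
      ≡⟨ cong (_+ (cell i (u i) + cell a (u a))) (rk-as-sum (u t[ i , a ])) ⟩
    sum (λ p → cell p (u (tr i a p))) + (cell i (u i) + cell a (u a))
      ≡⟨ sum-≡-except₂ i≢a (λ p p≢i p≢a → cong (cell p ∘ u) (tr-other p≢i p≢a)) at-i,a ⟩
    sum (λ p → cell p (u p)) + (cell i (u a) + cell a (u i))
      ≡⟨ cong (_+ (cell i (u a) + cell a (u i))) (sym (rk-as-sum u)) ⟩
    rk u x y + (cell i (u a) + cell a (u i)) ∎
    where
    open ≡-Reasoning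
    swapped : cell i (u (tr i a i)) + cell a (u (tr i a a)) ≡ cell i (u a) + cell a (u i)
    swapped = cong₂ _+_ (cong (cell i ∘ u) (tr-left i a)) (cong (cell a ∘ u) (tr-right i a))
    at-i,a : cell i (u (tr i a i)) + cell a (u (tr i a a)) + (cell i (u i) + cell a (u a))
           ≡ cell i (u i) + cell a (u a) + (cell i (u a) + cell a (u i))
    at-i,a = trans (+-comm (cell i (u (tr i a i)) + cell a (u (tr i a a))) _) (cong (cell i (u i) + cell a (u a) +_) swapped)

  rk-swap-inside : (u : Fun n) {i a : Fin n} → i ≤ᶠ x → x <ᶠ a →
                   rk (u t[ i , a ]) x y + χ (u i ≤? y) ≡ rk u x y + χ (u a ≤? y)
  rk-swap-inside u {i} {a} i≤x x<a = begin
    rk (u t[ i , a ]) x y + χ (u i ≤? y)         ≡⟨ cong (rk (u t[ i , a ]) x y +_) (sym (+-identityʳ _)) ⟩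
    rk (u t[ i , a ]) x y + (χ (u i ≤? y) + 0)   ≡⟨ cong (rk (u t[ i , a ]) x y +_)
                                                      (sym (cong₂ _+_ (cell-in (u i) i≤x) (cell-out (u a) a≰x))) ⟩
    rk (u t[ i , a ]) x y + (cell i (u i) + cell a (u a)) ≡⟨ rk-swap u (<⇒≢ᶠ (≤-<-trans i≤x x<a)) ⟩
    rk u x y + (cell i (u a) + cell a (u i))     ≡⟨ cong (rk u x y +_) (cong₂ _+_ (cell-in (u a) i≤x) (cell-out (u i) a≰x)) ⟩
    rk u x y + (χ (u a ≤? y) + 0)                ≡⟨ cong (rk u x y +_) (+-identityʳ _) ⟩
    rk u x y + χ (u a ≤? y)                      ∎
    where
    open ≡-Reasoning
    a≰x : ¬ a ≤ᶠ x
    a≰x = <⇒≱ x<a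

  rk-swap-same-side : (u : Fun n) {i a : Fin n} → i ≢ a → χ (i ≤? x) ≡ χ (a ≤? x) →
                      rk (u t[ i , a ]) x y ≡ rk u x y
  rk-swap-same-side u {i} {a} i≢a same =
    +-cancelʳ-≡ (cell i (u i) + cell a (u a)) _ _ (trans (rk-swap u i≢a) (cong (rk u x y +_) exchange))
    where
    open ≡-Reasoning
    exchange : cell i (u a) + cell a (u i) ≡ cell i (u i) + cell a (u a)
    exchange = begin
      cell i (u a) + cell a (u i) ≡⟨ +-comm (cell i (u a)) _ ⟩
      cell a (u i) + cell i (u a) ≡⟨ cong₂ _+_ (cong (_* χ (u i ≤? y)) (sym same)) (cong (_* χ (u a ≤? y)) same) ⟩
      cell i (u i) + cell a (u a) ∎

  rk-swap-outside : (u : Fun n) {i a : Fin n} → i <ᶠ a → x <ᶠ i ⊎ a ≤ᶠ x → rk (u t[ i , a ]) x y ≡ rk u x y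
  rk-swap-outside u {i} {a} i<a (inj₁ x<i) =
    rk-swap-same-side u (<⇒≢ᶠ i<a) (trans (χ-no {d = i ≤? x} (<⇒≱ x<i)) (sym (χ-no {d = a ≤? x} (<⇒≱ (<-trans x<i i<a)))))
  rk-swap-outside u {i} {a} i<a (inj₂ a≤x) =
    rk-swap-same-side u (<⇒≢ᶠ i<a) (trans (χ-yes {d = i ≤? x} (≤-trans (<⇒≤ i<a) a≤x)) (sym (χ-yes {d = a ≤? x} a≤x)))

Invertible : ∀ {n} → Fun n → Set
Invertible {n} u = Σ (Fun n) λ g → (∀ x → g (u x) ≡ x) × (∀ y → u (g y) ≡ y)

invertible-injective : ∀ {n} {u : Fun n} → Invertible u → ∀ {x x′} → u x ≡ u x′ → x ≡ x′
invertible-injective (g , gu , _) {x} {x′} eq = trans (sym (gu x)) (trans (cong g eq) (gu x′))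

invertible-swap : ∀ {n} {u : Fun n} (i a : Fin n) → Invertible u → Invertible (u t[ i , a ])
invertible-swap {u = u} i a (g , gu , ug) =
  tr i a ∘ g ,
  (λ x → trans (cong (tr i a) (gu (tr i a x))) (tr-involutive i a x)) ,
  (λ y → trans (cong u (tr-involutive i a (g y))) (ug y))

invertible-cong : ∀ {n} {u u′ : Fun n} → (∀ x → u x ≡ u′ x) → Invertible u → Invertible u′
invertible-cong u≗u′ (g , gu , ug) =
  g , (λ x → trans (cong g (sym (u≗u′ x))) (gu x)) , (λ y → trans (sym (u≗u′ (g y))) (ug y))

≤B-swap⇒< : ∀ {n} {v : Fun n} {i a : Fin n} → Invertible v → i <ᶠ a → v ≤B (v t[ i , a ]) → v i <ᶠ v a
≤B-swap⇒< {v = v} {i} {a} v-inv i<a v≤vt with v i <? v a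
... | yes vi<va = vi<va
... | no vi≮va = ⊥-elim (1+n≰n (begin
  1 + rk v i (v a)                                ≡⟨ +-comm 1 _ ⟩
  rk v i (v a) + 1                                ≡⟨ cong (rk v i (v a) +_) (sym (χ-yes {d = v a ≤? v a} ≤-refl)) ⟩
  rk v i (v a) + χ (v a ≤? v a)                   ≡⟨ sym (rk-swap-inside i (v a) v ≤-refl i<a) ⟩
  rk (v t[ i , a ]) i (v a) + χ (v i ≤? v a)      ≡⟨ cong (rk (v t[ i , a ]) i (v a) +_) (χ-no {d = v i ≤? v a} (<⇒≱ va<vi)) ⟩
  rk (v t[ i , a ]) i (v a) + 0                   ≡⟨ +-identityʳ _ ⟩
  rk (v t[ i , a ]) i (v a)                       ≤⟨ v≤vt i (v a) ⟩
  rk v i (v a)                                    ∎))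
  where
  open ≤-Reasoning
  va<vi : v a <ᶠ v i
  va<vi = ≤∧≢⇒<ᶠ (≮⇒≥ vi≮va) (λ va≡vi → <⇒≢ᶠ i<a (invertible-injective v-inv (sym va≡vi)))

inv : ∀ {n} → Fun n → Fin n → Fin n → ℕ
inv u p q = χ (p <? q) * χ (u q <? u p)

inv-≡ : ∀ {n} (u : Fun n) (p q : Fin n) {s t : Fin n} → u q ≡ s → u p ≡ t → inv u p q ≡ χ (p <? q) * χ (s <? t)
inv-≡ u p q refl refl = refl

inv-≡0-positions : ∀ {n} (u : Fun n) (p q : Fin n) → ¬ p <ᶠ q → inv u p q ≡ 0
inv-≡0-positions u p q p≮q = cong (_* χ (u q <? u p)) (χ-no {d = p <? q} p≮q)

inv-≡0-values : ∀ {n} (u : Fun n) (p q : Fin n) → ¬ u q <ᶠ u p → inv u p q ≡ 0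
inv-≡0-values u p q uq≮up = trans (cong (χ (p <? q) *_) (χ-no {d = u q <? u p} uq≮up)) (*-zeroʳ (χ (p <? q)))

inv-≡1 : ∀ {n} (u : Fun n) (p q : Fin n) → p <ᶠ q → u q <ᶠ u p → inv u p q ≡ 1
inv-≡1 u p q p<q uq<up = cong₂ _*_ (χ-yes {d = p <? q} p<q) (χ-yes {d = u q <? u p} uq<up)

length-filter-cartesianProduct : ∀ {a} {A : Set a} {m} {P : Pred (A × A) a} (P? : Decidable P)
  (h : Fin m → A) (ys : List A) →
  length (filter P? (cartesianProduct (tabulate h) ys)) ≡ sum (λ p → length (filter P? (map (h p ,_) ys)))
length-filter-cartesianProduct {m = zero} P? h ys = refl
length-filter-cartesianProduct {m = suc m} P? h ys = begin
  length (filter P? (map (h zero ,_) ys ++ cartesianProduct (tabulate (h ∘ suc)) ys))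
    ≡⟨ cong length (filter-++ P? (map (h zero ,_) ys) _) ⟩
  length (filter P? (map (h zero ,_) ys) ++ filter P? (cartesianProduct (tabulate (h ∘ suc)) ys))
    ≡⟨ length-++ (filter P? (map (h zero ,_) ys)) ⟩
  length (filter P? (map (h zero ,_) ys)) + length (filter P? (cartesianProduct (tabulate (h ∘ suc)) ys))
    ≡⟨ cong (length (filter P? (map (h zero ,_) ys)) +_) (length-filter-cartesianProduct P? (h ∘ suc) ys) ⟩
  length (filter P? (map (h zero ,_) ys)) + sum (λ p → length (filter P? (map (h (suc p) ,_) ys))) ∎
  where open ≡-Reasoning

ℓ-as-sum : ∀ {n} (u : Fun n) → ℓ u ≡ sum (λ p → sum (inv u p))
ℓ-as-sum {n} u = trans (length-filter-cartesianProduct P? id (allFin n)) (sum-cong-≗ row)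
  where
  P? : Decidable (λ (pq : Fin n × Fin n) → proj₁ pq <ᶠ proj₂ pq × u (proj₂ pq) <ᶠ u (proj₁ pq))
  P? (p , q) = (p <? q) ×-dec (u q <? u p)
  row : ∀ p → length (filter P? (map (p ,_) (allFin n))) ≡ sum (inv u p)
  row p = begin
    length (filter P? (map (p ,_) (allFin n)))   ≡⟨ cong (length ∘ filter P?) (map-tabulate id (p ,_)) ⟩
    length (filter P? (tabulate (p ,_)))          ≡⟨ length-filter-tabulate P? (p ,_) ⟩
    sum (λ q → χ ((p <? q) ×-dec (u q <? u p)))  ≡⟨ sum-cong-≗ (λ q → χ-×-dec (p <? q) (u q <? u p)) ⟩
    sum (inv u p)                                 ∎
    where open ≡-Reasoning

rearrangement : ∀ {a b x y : ℕ} → a ≤ b → y ≤ x → a * x + b * y ≤ a * y + b * x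
rearrangement {a} {y = y} a≤b y≤x with m≤n⇒∃[o]m+o≡n a≤b | m≤n⇒∃[o]m+o≡n y≤x
... | d , refl | e , refl = ≤-trans (m≤m+n _ (d * e)) (≤-reflexive (expand a d y e))
  where
  expand : ∀ a d y e → a * (y + e) + (a + d) * y + d * e ≡ a * y + (a + d) * (y + e)
  expand = solve-∀

module _ {n : ℕ} (v : Fun n) {i a : Fin n} (i<a : i <ᶠ a) (vi<va : v i <ᶠ v a) where

  private
    u : Fun n
    u = v t[ i , a ]

    i≢a : i ≢ a
    i≢a = <⇒≢ᶠ i<a

    u-i : u i ≡ v a
    u-i = cong v (tr-left i a)

    u-a : u a ≡ v i
    u-a = cong v (tr-right i a)

    u-other : ∀ {q} → q ≢ i → q ≢ a → u q ≡ v q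
    u-other q≢i q≢a = cong v (tr-other q≢i q≢a)

    strip : ∀ {m k} → m + 0 ≤ k + 0 → m ≤ k
    strip = subst₂ _≤_ (+-identityʳ _) (+-identityʳ _)

  inv-row-swap : ∀ p → p ≢ i → p ≢ a → sum (inv v p) ≤ sum (inv (v t[ i , a ]) p)
  inv-row-swap p p≢i p≢a = strip (sum-≤-except₂ i≢a off at-i,a)
    where
    open ≤-Reasoning
    off : ∀ q → q ≢ i → q ≢ a → inv v p q ≤ inv u p q
    off q q≢i q≢a = ≤-reflexive (sym (inv-≡ u p q (u-other q≢i q≢a) (u-other p≢i p≢a)))
    at-i,a : inv v p i + inv v p a + 0 ≤ inv u p i + inv u p a + 0
    at-i,a = begin
      inv v p i + inv v p a + 0                                  ≡⟨ +-identityʳ _ ⟩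
      χ (p <? i) * χ (v i <? v p) + χ (p <? a) * χ (v a <? v p)  ≤⟨ rearrangement (χ-mono (p <? i) (p <? a) (λ p<i → <-trans p<i i<a))
                                                                                   (χ-mono (v a <? v p) (v i <? v p) (<-trans vi<va)) ⟩
      χ (p <? i) * χ (v a <? v p) + χ (p <? a) * χ (v i <? v p)  ≡⟨ sym (cong₂ _+_ (inv-≡ u p i u-i (u-other p≢i p≢a))
                                                                                 (inv-≡ u p a u-a (u-other p≢i p≢a))) ⟩
      inv u p i + inv u p a                                      ≡⟨ sym (+-identityʳ _) ⟩
      inv u p i + inv u p a + 0                                  ∎

  inv-rows-swap : ∀ {j} → i <ᶠ j → j <ᶠ a → v i <ᶠ v j → v j <ᶠ v a →
                  sum (inv v i) + sum (inv v a) + 2 ≤ sum (inv (v t[ i , a ]) i) + sum (inv (v t[ i , a ]) a)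
  inv-rows-swap {j} i<j j<a vi<vj vj<va = begin
    sum (inv v i) + sum (inv v a) + 2  ≡⟨ cong (_+ 2) (sym (∑-distrib-+ (inv v i) (inv v a))) ⟩
    sum E + 2                          ≤⟨ sum-≤-except₂ j≢a off (≤-reflexive at-j,a) ⟩
    sum D + 0                          ≡⟨ +-identityʳ (sum D) ⟩
    sum D                              ≡⟨ ∑-distrib-+ (inv u i) (inv u a) ⟩
    sum (inv u i) + sum (inv u a)      ∎
    where
    open ≤-Reasoning
    E D : Fin n → ℕ
    E q = inv v i q + inv v a q
    D q = inv u i q + inv u a q
    j≢i : j ≢ i
    j≢i j≡i = <⇒≢ᶠ i<j (sym j≡i)
    j≢a : j ≢ a
    j≢a = <⇒≢ᶠ j<a
    off : ∀ q → q ≢ j → q ≢ a → E q ≤ D q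
    -- A with on q ≟ i would also abstract the same test inside u q = v (tr i a q).
    off q q≢j q≢a = by-cases (q ≟ i)
     where
     by-cases : Dec (q ≡ i) → E q ≤ D q
     by-cases (yes refl) = ≤-trans (≤-reflexive (cong₂ _+_ (inv-≡0-positions v i i (<-irrefl refl)) (inv-≡0-positions v a i (<⇒≯ i<a)))) z≤n
     by-cases (no q≢i) = begin
      χ (i <? q) * χ (v q <? v i) + χ (a <? q) * χ (v q <? v a)  ≡⟨ +-comm (χ (i <? q) * χ (v q <? v i)) _ ⟩
      χ (a <? q) * χ (v q <? v a) + χ (i <? q) * χ (v q <? v i)  ≤⟨ rearrangement (χ-mono (a <? q) (i <? q) (<-trans i<a))
                                                                                   (χ-mono (v q <? v i) (v q <? v a) (λ vq<vi → <-trans vq<vi vi<va)) ⟩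
      χ (a <? q) * χ (v q <? v i) + χ (i <? q) * χ (v q <? v a)  ≡⟨ +-comm (χ (a <? q) * χ (v q <? v i)) _ ⟩
      χ (i <? q) * χ (v q <? v a) + χ (a <? q) * χ (v q <? v i)  ≡⟨ sym (cong₂ _+_ (inv-≡ u i q (u-other q≢i q≢a) u-i)
                                                                                 (inv-≡ u a q (u-other q≢i q≢a) u-a)) ⟩
      D q                                                        ∎
    at-j,a : E j + E a + 2 ≡ D j + D a + 0
    at-j,a = trans (cong₂ (λ s t → s + t + 2) E-j E-a) (sym (cong₂ (λ s t → s + t + 0) D-j D-a))
      where
      E-j : E j ≡ 0
      E-j = cong₂ _+_ (inv-≡0-values v i j (<⇒≯ vi<vj)) (inv-≡0-positions v a j (<⇒≯ j<a))
      E-a : E a ≡ 0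
      E-a = cong₂ _+_ (inv-≡0-values v i a (<⇒≯ vi<va)) (inv-≡0-positions v a a (<-irrefl refl))
      D-j : D j ≡ 1
      D-j = cong₂ _+_ (inv-≡1 u i j i<j (subst₂ _<ᶠ_ (sym (u-other j≢i j≢a)) (sym u-i) vj<va)) (inv-≡0-positions u a j (<⇒≯ j<a))
      D-a : D a ≡ 1
      D-a = cong₂ _+_ (inv-≡1 u i a i<a (subst₂ _<ᶠ_ (sym u-a) (sym u-i) vi<va)) (inv-≡0-positions u a a (<-irrefl refl))

  ℓ-swap-over-middle : ∀ {j} → i <ᶠ j → j <ᶠ a → v i <ᶠ v j → v j <ᶠ v a → ℓ v + 2 ≤ ℓ (v t[ i , a ])
  ℓ-swap-over-middle i<j j<a vi<vj vj<va = begin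
    ℓ v + 2                                ≡⟨ cong (_+ 2) (ℓ-as-sum v) ⟩
    sum (λ p → sum (inv v p)) + 2          ≤⟨ sum-≤-except₂ i≢a inv-row-swap at-i,a ⟩
    sum (λ p → sum (inv u p)) + 0          ≡⟨ +-identityʳ _ ⟩
    sum (λ p → sum (inv u p))              ≡⟨ sym (ℓ-as-sum u) ⟩
    ℓ u                                    ∎
    where
    open ≤-Reasoning
    at-i,a : sum (inv v i) + sum (inv v a) + 2 ≤ sum (inv u i) + sum (inv u a) + 0
    at-i,a = ≤-trans (inv-rows-swap i<j j<a vi<vj vj<va) (≤-reflexive (sym (+-identityʳ _)))

ℓ-swap-cover⇒> : ∀ {n} {v : Fun n} {i q a : Fin n} → Invertible v → i <ᶠ q → q <ᶠ a →
                 v i <ᶠ v a → v q <ᶠ v a → ℓ (v t[ i , a ]) ≡ suc (ℓ v) → v q <ᶠ v i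
ℓ-swap-cover⇒> {v = v} {i} {q} {a} v-inv i<q q<a vi<va vq<va cover with v q <? v i
... | yes vq<vi = vq<vi
... | no vq≮vi = ⊥-elim (1+n≰n (≤-trans (≤-reflexive (+-comm 2 (ℓ v)))
                                (≤-trans (ℓ-swap-over-middle v (<-trans i<q q<a) vi<va i<q q<a vi<vq vq<va) (≤-reflexive cover))))
  where
  vi<vq : v i <ᶠ v q
  vi<vq = ≤∧≢⇒<ᶠ (≮⇒≥ vq≮vi) (λ vi≡vq → <⇒≢ᶠ i<q (invertible-injective v-inv vi≡vq))

AllPairs-map-on : ∀ {a p r s} {A : Set a} {P : Pred A p} {R : A → A → Set r} {S : A → A → Set s} {xs : List A} →
                  (∀ {x y} → P x → P y → R x y → S x y) → All P xs → AllPairs R xs → AllPairs S xs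
AllPairs-map-on R⇒S [] [] = []
AllPairs-map-on R⇒S (px ∷ pxs) (rxs ∷ rs) =
  All.zipWith (λ (py , rxy) → R⇒S px py rxy) (pxs , rxs) ∷ AllPairs-map-on R⇒S pxs rs

_t*[_,_] : ∀ {n} → Fun n → List (Fin n) → Fin n → Fun n
u t*[ U , a ] = foldl (λ u′ i → u′ t[ i , a ]) u U

invertible-swaps : ∀ {n} {u : Fun n} (U : List (Fin n)) (a : Fin n) → Invertible u → Invertible (u t*[ U , a ])
invertible-swaps [] a u-inv = u-inv
invertible-swaps (i ∷ U) a u-inv = invertible-swaps U a (invertible-swap i a u-inv)

swaps-as-composite : ∀ {n} (u : Fun n) (a : Fin n) U x → u (foldr (λ i → tr i a) x U) ≡ (u t*[ U , a ]) x
swaps-as-composite u a [] x = refl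
swaps-as-composite u a (i ∷ U) x = swaps-as-composite (u t[ i , a ]) a U x

module _ {n : ℕ} (c : Fin n) where

  private
    step : Fin n → Fin n → Fin n
    step x z = tr z c x

  foldl-tr-fixes : ∀ {y} zs → y ≢ c → All (y ≢_) zs → foldl step y zs ≡ y
  foldl-tr-fixes [] y≢c [] = refl
  foldl-tr-fixes (z ∷ zs) y≢c (y≢z ∷ y∉zs) = trans (cong (λ y′ → foldl step y′ zs) (tr-other y≢z y≢c)) (foldl-tr-fixes zs y≢c y∉zs)

  cycleGo-as-transpositions : ∀ y zs x → y ≢ c → x ≢ c → All (_≢ c) zs → AllPairs _≢_ zs →
                              cycleGo c y zs x ≡ foldl step (tr y c x) zs
  -- Matching on x ≟ y and then x ≟ c also evaluates tr y c x on the right.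
  cycleGo-as-transpositions y [] x y≢c x≢c [] [] with x ≟ y
  ... | yes refl = refl
  ... | no _ with x ≟ c
  ...   | yes x≡c = ⊥-elim (x≢c x≡c)
  ...   | no _ = refl
  cycleGo-as-transpositions y (z ∷ zs) x y≢c x≢c (z≢c ∷ zs≢c) (z∉zs ∷ zs!) with x ≟ y
  ... | yes refl = sym (trans (cong (λ t → foldl step t zs) (tr-right z c)) (foldl-tr-fixes zs z≢c z∉zs))
  ... | no _ with x ≟ c
  ...   | yes x≡c = ⊥-elim (x≢c x≡c)
  ...   | no _ = cycleGo-as-transpositions z zs x z≢c x≢c zs≢c zs!

  cycleFn-as-transpositions : ∀ zs x → All (_≢ c) zs → AllPairs _≢_ zs → cycleFn (c ∷ zs) x ≡ foldl step x zs
  cycleFn-as-transpositions [] x [] [] with x ≟ c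
  ... | yes refl = refl
  ... | no _ = refl
  cycleFn-as-transpositions (z ∷ zs) x (z≢c ∷ zs≢c) (z∉zs ∷ zs!) with x ≟ c
  ... | yes refl = sym (trans (cong (λ t → foldl step t zs) (tr-right z c)) (foldl-tr-fixes zs z≢c z∉zs))
  ... | no x≢c = cycleGo-as-transpositions z zs x z≢c x≢c zs≢c zs!

module _ {n : ℕ} (U : List (Fin n)) where

  private
    U↭reverse : Perm._↭_ (setoid (Fin n)) U (reverse U)
    U↭reverse = Perm.↭-sym (setoid (Fin n)) (PermProps.↭-reverse (setoid (Fin n)) U)

  All-reverse : {P : Fin n → Set} → All P U → All P (reverse U)
  All-reverse {P} = PermProps.All-resp-↭ (setoid (Fin n)) (subst P) U↭reverse

  distinct-reverse : AllPairs _≢_ U → AllPairs _≢_ (reverse U)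
  distinct-reverse = PermProps.Unique-resp-↭ (setoid (Fin n)) U↭reverse

wU-as-swaps : ∀ {n} (w : Permutation′ n) (a b : Fin n) (U : List (Fin n)) → AllPairs _<ᶠ_ U → All (_<ᶠ a) U →
              ∀ x → wU w a b U x ≡ (vOf w a b t*[ U , a ]) x
wU-as-swaps w a b U increasing below-a x = begin
  vOf w a b (cycleFn (a ∷ reverse U) x)               ≡⟨ cong (vOf w a b) (cycleFn-as-transpositions a (reverse U) x
                                                          (All-reverse U (All.map <⇒≢ᶠ below-a))
                                                          (distinct-reverse U (AllPairs.map <⇒≢ᶠ increasing))) ⟩
  vOf w a b (foldl (λ x′ z → tr z a x′) x (reverse U)) ≡⟨ cong (vOf w a b) (reverse-foldl (λ x′ z → tr z a x′) x U) ⟩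
  vOf w a b (foldr (λ i → tr i a) x U)                 ≡⟨ swaps-as-composite (vOf w a b) a U x ⟩
  (vOf w a b t*[ U , a ]) x                            ∎
  where open ≡-Reasoning

IsMinimum : ∀ {A : Set} → List A → (A → ℕ) → ℕ → Set
IsMinimum U f r = (∀ {j} → j ∈ U → r ≤ f j) × (U ≢ [] → ∃[ m ] (m ∈ U × f m ≤ r))

constant-isMinimum : ∀ {A : Set} {f : A → ℕ} {r : ℕ} (U : List A) → (∀ {j} → j ∈ U → f j ≡ r) → IsMinimum U f r
constant-isMinimum [] _ = (λ ()) , λ []≢[] → ⊥-elim ([]≢[] refl)
constant-isMinimum (m ∷ U) f≡r = (λ j∈U → ≤-reflexive (sym (f≡r j∈U))) , λ _ → m , here refl , ≤-reflexive (f≡r (here refl))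

module _ {n : ℕ} (a x y : Fin n) where

  rk-swaps-outside : (u : Fun n) (U : List (Fin n)) → All (λ j → j <ᶠ a × (x <ᶠ j ⊎ a ≤ᶠ x)) U →
                     rk (u t*[ U , a ]) x y ≡ rk u x y
  rk-swaps-outside u [] [] = refl
  rk-swaps-outside u (j ∷ U) ((j<a , outside) ∷ os) =
    trans (rk-swaps-outside (u t[ j , a ]) U os) (rk-swap-outside x y u j<a outside)

  module _ (v : Fun n) (x<a : x <ᶠ a) where

    -- For u t*[ U , a ] with x < a: either no j ∈ U lies in the rows ≤ x, or, for the last such m,
    -- the swaps have traded v m (moved out of those rows) for u a (moved in).
    data Exchange (u : Fun n) (U : List (Fin n)) : Set where
      none : All (x <ᶠ_) U → Exchange u U
      last : ∀ m → m ∈ U → m ≤ᶠ x → (∀ {j} → j ∈ U → j ≤ᶠ x → v m ≤ᶠ v j) →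
             rk (u t*[ U , a ]) x y + χ (v m ≤? y) ≡ rk u x y + χ (u a ≤? y) → Exchange u U

    exchange : ∀ u U → AllPairs _<ᶠ_ U → All (_<ᶠ a) U → AllPairs (λ p q → v q <ᶠ v p) U →
               (∀ {j} → j ∈ U → u j ≡ v j) → Exchange u U
    exchange u [] [] [] [] _ = none []
    exchange u (i ∷ U) (i<U ∷ increasing) (i<a ∷ below-a) (vU<vi ∷ decreasing) u≡v with i ≤? x
    ... | no i≰x = none (x<i ∷ All.map (<-trans x<i) i<U)
      where
      x<i : x <ᶠ i
      x<i = ≰⇒> i≰x
    ... | yes i≤x with exchange (u t[ i , a ]) U increasing below-a decreasing u′≡v
      where
      u′≡v : ∀ {j} → j ∈ U → (u t[ i , a ]) j ≡ v j
      u′≡v j∈U = trans (cong u (tr-other (λ j≡i → <⇒≢ᶠ (All.lookup i<U j∈U) (sym j≡i)) (<⇒≢ᶠ (All.lookup below-a j∈U))))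
                       (u≡v (there j∈U))
    ...   | none x<U = last i (here refl) i≤x i-minimal (begin
      rk ((u t[ i , a ]) t*[ U , a ]) x y + χ (v i ≤? y) ≡⟨ cong₂ _+_ (rk-swaps-outside (u t[ i , a ]) U untouched)
                                                                (cong (λ z → χ (z ≤? y)) (sym (u≡v (here refl)))) ⟩
      rk (u t[ i , a ]) x y + χ (u i ≤? y)              ≡⟨ rk-swap-inside x y u i≤x x<a ⟩
      rk u x y + χ (u a ≤? y)                           ∎)
      where
      open ≡-Reasoning
      untouched : All (λ j → j <ᶠ a × (x <ᶠ j ⊎ a ≤ᶠ x)) U
      untouched = All.zipWith (λ (j<a , x<j) → j<a , inj₁ x<j) (below-a , x<U)
      i-minimal : ∀ {j} → j ∈ i ∷ U → j ≤ᶠ x → v i ≤ᶠ v j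
      i-minimal (here refl) _ = ≤-refl
      i-minimal (there j∈U) j≤x = ⊥-elim (<⇒≱ (All.lookup x<U j∈U) j≤x)
    ...   | last m m∈U m≤x m-minimal exchanged = last m (there m∈U) m≤x m-minimal′ (begin
      rk ((u t[ i , a ]) t*[ U , a ]) x y + χ (v m ≤? y) ≡⟨ exchanged ⟩
      rk (u t[ i , a ]) x y + χ (u (tr i a a) ≤? y)     ≡⟨ cong (λ z → rk (u t[ i , a ]) x y + χ (u z ≤? y)) (tr-right i a) ⟩
      rk (u t[ i , a ]) x y + χ (u i ≤? y)              ≡⟨ rk-swap-inside x y u i≤x x<a ⟩
      rk u x y + χ (u a ≤? y)                           ∎)
      where
      open ≡-Reasoning
      m-minimal′ : ∀ {j} → j ∈ i ∷ U → j ≤ᶠ x → v m ≤ᶠ v j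
      m-minimal′ (here refl) _ = <⇒≤ (All.lookup vU<vi m∈U)
      m-minimal′ (there j∈U) = m-minimal j∈U

    rk-swaps-minimum-below : (U : List (Fin n)) → AllPairs _<ᶠ_ U → All (_<ᶠ a) U →
                             AllPairs (λ p q → v q <ᶠ v p) U → All (λ j → v j <ᶠ v a) U →
                             IsMinimum U (λ j → rk (v t[ j , a ]) x y) (rk (v t*[ U , a ]) x y)
    rk-swaps-minimum-below U increasing below-a decreasing below-va with exchange v U increasing below-a decreasing (λ _ → refl)
    ... | none x<U = constant-isMinimum U (λ j∈U →
          trans (rk-swap-outside x y v (All.lookup below-a j∈U) (inj₁ (All.lookup x<U j∈U))) (sym (rk-swaps-outside v U untouched)))
      where
      untouched : All (λ j → j <ᶠ a × (x <ᶠ j ⊎ a ≤ᶠ x)) U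
      untouched = All.zipWith (λ (j<a , x<j) → j<a , inj₁ x<j) (below-a , x<U)
    ... | last m m∈U m≤x m-minimal exchanged = below-each , λ _ → m , m∈U , ≤-reflexive attained
      where
      open ≤-Reasoning
      attained : rk (v t[ m , a ]) x y ≡ rk (v t*[ U , a ]) x y
      attained = +-cancelʳ-≡ (χ (v m ≤? y)) _ _ (trans (rk-swap-inside x y v m≤x x<a) (sym exchanged))
      below-each : ∀ {j} → j ∈ U → rk (v t*[ U , a ]) x y ≤ rk (v t[ j , a ]) x y
      below-each {j} j∈U with j ≤? x
      ... | yes j≤x = +-cancelʳ-≤ (χ (v m ≤? y)) _ _ (begin
        rk (v t*[ U , a ]) x y + χ (v m ≤? y) ≡⟨ exchanged ⟩
        rk v x y + χ (v a ≤? y)               ≡⟨ sym (rk-swap-inside x y v j≤x x<a) ⟩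
        rk (v t[ j , a ]) x y + χ (v j ≤? y)  ≤⟨ +-monoʳ-≤ _ (χ-mono (v j ≤? y) (v m ≤? y) (≤-trans (m-minimal j∈U j≤x))) ⟩
        rk (v t[ j , a ]) x y + χ (v m ≤? y)  ∎)
      ... | no j≰x = +-cancelʳ-≤ (χ (v m ≤? y)) _ _ (begin
        rk (v t*[ U , a ]) x y + χ (v m ≤? y) ≡⟨ exchanged ⟩
        rk v x y + χ (v a ≤? y)               ≤⟨ +-monoʳ-≤ _ (χ-mono (v a ≤? y) (v m ≤? y) (≤-trans (<⇒≤ (All.lookup below-va m∈U)))) ⟩
        rk v x y + χ (v m ≤? y)               ≡⟨ cong (_+ χ (v m ≤? y))
                                                   (sym (rk-swap-outside x y v (All.lookup below-a j∈U) (inj₁ (≰⇒> j≰x)))) ⟩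
        rk (v t[ j , a ]) x y + χ (v m ≤? y)  ∎)

  rk-swaps-minimum : (v : Fun n) (U : List (Fin n)) → AllPairs _<ᶠ_ U → All (_<ᶠ a) U →
                     AllPairs (λ p q → v q <ᶠ v p) U → All (λ j → v j <ᶠ v a) U →
                     IsMinimum U (λ j → rk (v t[ j , a ]) x y) (rk (v t*[ U , a ]) x y)
  rk-swaps-minimum v U increasing below-a decreasing below-va with x <? a
  ... | yes x<a = rk-swaps-minimum-below v x<a U increasing below-a decreasing below-va
  ... | no x≮a = constant-isMinimum U (λ j∈U →
        trans (rk-swap-outside x y v (All.lookup below-a j∈U) (inj₂ a≤x)) (sym (rk-swaps-outside v U untouched)))
    where
    a≤x : a ≤ᶠ x
    a≤x = ≮⇒≥ x≮a
    untouched : All (λ j → j <ᶠ a × (x <ᶠ j ⊎ a ≤ᶠ x)) U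
    untouched = All.map (λ j<a → j<a , inj₂ a≤x) below-a

ΣFin-cong : ∀ {n} {f g : Fin n → ℤ} → (∀ i → f i ≡ g i) → ΣFin f ≡ ΣFin g
ΣFin-cong {zero} f≡g = refl
ΣFin-cong {suc n} f≡g = cong₂ ℤ._+_ (f≡g zero) (ΣFin-cong (f≡g ∘ suc))

ΣFin-+ : ∀ {n} (h : Fin n → ℕ) → ΣFin (λ i → ℤ+ h i) ≡ ℤ+ sum h
ΣFin-+ {zero} h = refl
ΣFin-+ {suc n} h = cong (ℤ._+_ (ℤ+ h zero)) (ΣFin-+ (h ∘ suc))

-- ΣUpTo's summand is local to its definition; this names it so it can be rewritten pointwise.
ΣUpTo-summand : ∀ {n} (a : Fin n) (f : Fin n → ℤ) → Σ (Fin n → ℤ) λ g → ΣUpTo a f ≡ ΣFin g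
ΣUpTo-summand a f = _ , refl

ΣUpTo-+ : ∀ {n} (a : Fin n) (f : Fin n → ℤ) (h : Fin n → ℕ) → (∀ i → f i ≡ ℤ+ h i) →
          ΣUpTo a f ≡ ℤ+ sum (λ i → χ (i ≤? a) * h i)
ΣUpTo-+ a f h f≡h = trans (proj₂ (ΣUpTo-summand a f)) (trans (ΣFin-cong summand≡) (ΣFin-+ (λ i → χ (i ≤? a) * h i)))
  where
  summand≡ : ∀ i → proj₁ (ΣUpTo-summand a f) i ≡ ℤ+ (χ (i ≤? a) * h i)
  summand≡ i with i ≤? a
  ... | yes _ = trans (f≡h i) (cong ℤ+_ (sym (+-identityʳ (h i))))
  ... | no _ = refl

permMat-entry : ∀ {n} (u : Fun n) i j → permMat u i j ≡ ℤ+ χ (u i ≟ j)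
permMat-entry u i j with u i ≟ j
... | yes _ = refl
... | no _ = refl

permMat-nonzero : ∀ {n} (u : Fun n) {i j} → permMat u i j ≢ 0ℤ → u i ≡ j
permMat-nonzero u {i} {j} nonzero with u i ≟ j
... | yes ui≡j = ui≡j
... | no _ = ⊥-elim (nonzero refl)

rkA-permMat : ∀ {n} (u : Fun n) x y → rkA (permMat u) x y ≡ ℤ+ rk u x y
rkA-permMat u x y = begin
  ΣUpTo x (λ i → ΣUpTo y (permMat u i))     ≡⟨ ΣUpTo-+ x _ (λ i → χ (u i ≤? y)) row ⟩
  ℤ+ sum (λ i → χ (i ≤? x) * χ (u i ≤? y))   ≡⟨ cong ℤ+_ (sym (rk-as-sum x y u)) ⟩
  ℤ+ rk u x y                                ∎
  where
  open ≡-Reasoning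
  row : ∀ i → ΣUpTo y (permMat u i) ≡ ℤ+ χ (u i ≤? y)
  row i = trans (ΣUpTo-+ y _ (λ j → χ (u i ≟ j)) (permMat-entry u i)) (cong ℤ+_ (begin
    sum (λ j → χ (j ≤? y) * χ (u i ≟ j))   ≡⟨ sum-point (u i) (λ j j≢ui → trans (cong (χ (j ≤? y) *_) (χ-no {d = u i ≟ j} (j≢ui ∘ sym)))
                                                                      (*-zeroʳ (χ (j ≤? y)))) ⟩
    χ (u i ≤? y) * χ (u i ≟ u i)           ≡⟨ cong (χ (u i ≤? y) *_) (χ-yes {d = u i ≟ u i} refl) ⟩
    χ (u i ≤? y) * 1                       ≡⟨ *-identityʳ _ ⟩
    χ (u i ≤? y)                           ∎))

rkA-permMat-mono : ∀ {n} (u u′ : Fun n) x y → rk u x y ≤ rk u′ x y → rkA (permMat u) x y ℤ.≤ rkA (permMat u′) x y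
rkA-permMat-mono u u′ x y rk≤ = subst₂ ℤ._≤_ (sym (rkA-permMat u x y)) (sym (rkA-permMat u′ x y)) (ℤ.+≤+ rk≤)

permMat-isASM : ∀ {n} {u : Fun n} → Invertible u → IsASM (permMat u)
permMat-isASM {n} {u} u-inv@(g , gu , ug) = record
  { entries = entries ; rowSum = rowSum ; colSum = colSum ; rowAlt = rowAlt ; colAlt = colAlt }
  where
  entries : ∀ i j → (permMat u i j ≡ -1ℤ) ⊎ (permMat u i j ≡ 0ℤ) ⊎ (permMat u i j ≡ 1ℤ)
  entries i j with u i ≟ j
  ... | yes _ = inj₂ (inj₂ refl)
  ... | no _ = inj₂ (inj₁ refl)
  rowSum : ∀ i → ΣFin (permMat u i) ≡ 1ℤ
  rowSum i = trans (ΣFin-cong (permMat-entry u i)) (trans (ΣFin-+ (λ j → χ (u i ≟ j)))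
    (cong ℤ+_ (trans (sum-point (u i) (λ j j≢ui → χ-no {d = u i ≟ j} (j≢ui ∘ sym))) (χ-yes {d = u i ≟ u i} refl))))
  colSum : ∀ j → ΣFin (λ i → permMat u i j) ≡ 1ℤ
  colSum j = trans (ΣFin-cong (λ i → permMat-entry u i j)) (trans (ΣFin-+ (λ i → χ (u i ≟ j)))
    (cong ℤ+_ (trans (sum-point (g j) (λ i i≢gj → χ-no {d = u i ≟ j} (λ ui≡j → i≢gj (trans (sym (gu i)) (cong g ui≡j)))))
                    (χ-yes {d = u (g j) ≟ j} (ug j)))))
  rowAlt : ∀ i j j′ → j <ᶠ j′ → permMat u i j ≢ 0ℤ → permMat u i j ≡ permMat u i j′ →
           ∃[ k ] (j <ᶠ k × k <ᶠ j′ × permMat u i k ≢ 0ℤ)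
  rowAlt i j j′ j<j′ nonzero same =
    ⊥-elim (<⇒≢ᶠ j<j′ (trans (sym (permMat-nonzero u nonzero)) (permMat-nonzero u (nonzero ∘ trans same))))
  colAlt : ∀ j i i′ → i <ᶠ i′ → permMat u i j ≢ 0ℤ → permMat u i j ≡ permMat u i′ j →
           ∃[ k ] (i <ᶠ k × k <ᶠ i′ × permMat u k j ≢ 0ℤ)
  colAlt j i i′ i<i′ nonzero same =
    ⊥-elim (<⇒≢ᶠ i<i′ (invertible-injective u-inv (trans (permMat-nonzero u nonzero) (sym (permMat-nonzero u (nonzero ∘ trans same))))))

isJoin-attained : ∀ {n} {X : Set} {S : X → Set} {M : X → Matrix n} {J : Matrix n} → IsASM J →
                  (∀ s → S s → M s ⊑ J) → (∀ r c → ∃[ s ] (S s × rkA (M s) r c ℤ.≤ rkA J r c)) → IsJoin S M J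
isJoin-attained {S = S} {M} {J} J-asm upper attained = J-asm , upper , least
  where
  least : ∀ A → IsASM A → (∀ s → S s → M s ⊑ A) → J ⊑ A
  least A _ A-upper r c with attained r c
  ... | s , s∈S , Ms≤J = ℤₚ.≤-trans (A-upper s s∈S r c) Ms≤J

module _ {n : ℕ} (w : Permutation′ n) (a b : Fin n) where

  vOf-invertible : Invertible (vOf w a b)
  vOf-invertible = invertible-swap a (w ⟨$⟩ˡ b) ((w ⟨$⟩ˡ_) , (λ _ → inverseˡ w) , (λ _ → inverseʳ w))

  Inφ⇒below : ∀ {j} → Inφ w a b j → vOf w a b j <ᶠ vOf w a b a
  Inφ⇒below (j<a , (v≤vt , _) , _) = ≤B-swap⇒< vOf-invertible j<a v≤vt

  Inφ-decreasing : ∀ {U} → AllPairs _<ᶠ_ U → All (Inφ w a b) U → AllPairs (λ p q → vOf w a b q <ᶠ vOf w a b p) U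
  Inφ-decreasing increasing φ = AllPairs-map-on decrease φ increasing
    where
    decrease : ∀ {i q} → Inφ w a b i → Inφ w a b q → i <ᶠ q → vOf w a b q <ᶠ vOf w a b i
    decrease φi@(_ , _ , cover) φq@(q<a , _) i<q = ℓ-swap-cover⇒> vOf-invertible i<q q<a (Inφ⇒below φi) (Inφ⇒below φq) cover

lemma6p1 : (n : ℕ) (w : Permutation′ n) (a b : Fin n) →
    LowerOutsideCorner w a b →
    (U : List (Fin n)) → AllPairs _<ᶠ_ U → U ≢ [] →
    All (Inφ w a b) U →
    IsJoin (λ i → i ∈ U) (λ i → permMat ((vOf w a b) t[ i , a ])) (permMat (wU w a b U))
lemma6p1 n w a b _ U increasing nonempty φ = isJoin-attained (permMat-isASM wU-invertible) upper attained
  where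
  v : Fun n
  v = vOf w a b
  below-a : All (_<ᶠ a) U
  below-a = All.map proj₁ φ
  wU≗swaps : ∀ x → wU w a b U x ≡ (v t*[ U , a ]) x
  wU≗swaps = wU-as-swaps w a b U increasing below-a
  wU-invertible : Invertible (wU w a b U)
  wU-invertible = invertible-cong (sym ∘ wU≗swaps) (invertible-swaps U a (vOf-invertible w a b))
  minimum : ∀ r c → IsMinimum U (λ j → rk (v t[ j , a ]) r c) (rk (wU w a b U) r c)
  minimum r c rewrite rk-cong r c wU≗swaps =
    rk-swaps-minimum a r c v U increasing below-a (Inφ-decreasing w a b increasing φ) (All.map (Inφ⇒below w a b) φ)
  upper : ∀ i → i ∈ U → permMat (v t[ i , a ]) ⊑ permMat (wU w a b U)
  upper i i∈U r c = rkA-permMat-mono _ _ r c (proj₁ (minimum r c) i∈U)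
  attained : ∀ r c → ∃[ i ] (i ∈ U × rkA (permMat (v t[ i , a ])) r c ℤ.≤ rkA (permMat (wU w a b U)) r c)
  attained r c with proj₂ (minimum r c) nonempty
  ... | i , i∈U , rk≤ = i , i∈U , rkA-permMat-mono _ _ r c rk≤
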